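{- If $p\ge 11$ is a prime, then $b(p)\ge 2p+2$.
   Context: Let $P_n$ denote the $n$-th prime ($P_1=2$). For $n>1$, $a(n)$ is the integer such that $\prod_{r=n}^{n+a(n)-2}\frac{P_r}{P_r-1}<2<\prod_{r=n}^{n+a(n)-1}\frac{P_r}{P_r-1}$. For an odd prime $p=P_n$, set $b(p)=a(n)$. -}

module Defs where

open import Data.Nat using (ℕ; zero; suc; _+_; _∸_; _!)
open import Data.Nat.Primality using (Prime; prime?)
open import Data.Integer using (+_)
open import Data.Rational using (ℚ; _/_; _*_; _<_; 0ℚ; 1ℚ)
open import Relation.Nullary using (yes; no)
open import Data.Product using (_×_)

-- Bounded search: the first prime among s, s+1, ..., s+fuel-1
-- (returns s+fuel if none is found; this case never arises below).
firstPrimeFrom : ℕ → ℕ → ℕ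
firstPrimeFrom zero s = s
firstPrimeFrom (suc f) s with prime? s
... | yes _ = s
... | no  _ = firstPrimeFrom f (suc s)

-- The least prime > p.  By Euclid there is a prime in (p, p! + 1],
-- and the search window p+1 .. p+p! contains that interval.
nextPrime : ℕ → ℕ
nextPrime p = firstPrimeFrom (p !) (suc p)

-- P n = n-th prime, 1-indexed: P 1 = 2, P 2 = 3, P 3 = 5, ...
-- (P 0 is a junk value, never used.)
P : ℕ → ℕ
P zero = 2
P (suc zero) = 2
P (suc (suc n)) = nextPrime (P (suc n))

-- The factor q / (q - 1) as a rational number (q ≥ 2; junk 0 otherwise).
factor : ℕ → ℚ
factor zero = 0ℚ
factor (suc zero) = 0ℚ
factor (suc (suc k)) = (+ (suc (suc k))) / (suc k)

prodFrom : ℕ → ℕ → ℚ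
prodFrom n zero = 1ℚ
prodFrom n (suc k) = factor (P n) * prodFrom (suc n) k

two : ℚ
two = (+ 2) / 1

-- IsA n a : "a(n) = a", i.e.
--   ∏_{r=n}^{n+a-2} P_r/(P_r-1) < 2 < ∏_{r=n}^{n+a-1} P_r/(P_r-1)
IsA : ℕ → ℕ → Set
IsA n a = (prodFrom n (a ∸ 1) < two) × (two < prodFrom n a)

module Submission where

-- For a prime p = P n ≥ 11 we show that the product of the 2p + 2 factors
-- q/(q − 1), q running through P n, P (n+1), ..., is at most 2.  Since every
-- factor exceeds 1 the partial products increase, so the first product
-- exceeding 2 has at least 2p + 2 factors, i.e. b(p) = a(n) ≥ 2p + 2.
--
-- The bound is proved in the integers, for numerator and denominator of the
-- product.  The key estimate is ((m+2)/(m+1))³ ≤ (m+3)/m; combined with the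
-- gap property "of three consecutive primes ≥ 5 the last exceeds the first
-- by at least 6", it shows that two consecutive primes q < q' with
-- q ≥ y + 3 satisfy (q/(q−1))³ (q'/(q'−1))³ ≤ (y+6)/y.  Telescoping over
-- p + 1 pairs starting at p = y + 3 gives (∏)³ ≤ (7p+3)/(p−3) ≤ 8 for p ≥ 27;
-- the primes 11, 13, 17, 19, 23 are checked by computation.

open import Defs
open import Data.Nat
open import Data.Nat.Properties
open import Data.Nat.Divisibility
open import Data.Nat.Primality
open import Data.Nat.Primality.Factorisation using (PrimeFactorisation; factorise)
open import Data.Nat.ListAction using (product)
open import Data.Nat.Tactic.RingSolver using (solve-∀)
open import Data.List using (List; _∷_)
open import Data.List.Relation.Unary.All using (All; _∷_)
open import Data.Product using (_×_; _,_; proj₁; proj₂; ∃-syntax; map₂)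
open import Data.Sum using (_⊎_; inj₁; inj₂)
open import Data.Unit using (tt)
open import Relation.Nullary using (¬_; yes; no; contradiction)
open import Relation.Nullary.Decidable using (toWitness; _→-dec_)
open import Relation.Binary.PropositionalEquality
open import Data.Integer as ℤ using (+_)
import Data.Integer.Properties as ℤ
open import Data.Rational as ℚ using (ℚ; toℚᵘ)
import Data.Rational.Properties as ℚ
open import Data.Rational.Unnormalised as ℚᵘ using (mkℚᵘ; _≃_; *<*)
import Data.Rational.Unnormalised.Properties as ℚᵘ

prime≥2 : ∀ {q} → Prime q → 2 ≤ q
prime≥2 {q} pq = nonTrivial⇒n>1 q {{prime⇒nonTrivial pq}}

∣-factorial : ∀ {k n} → 1 ≤ k → k ≤ n → k ∣ n !
∣-factorial {suc k} _ k≤n = ∣-trans (m∣m*n (k !)) (m≤n⇒m!∣n! k≤n)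

primeDivisor : ∀ n → 2 ≤ n → ∃[ q ] Prime q × q ∣ n
primeDivisor 1 (s≤s ())
primeDivisor n@(suc (suc _)) _ = fromFactors (factors f) (isFactorisation f) (factorsPrime f)
  where
  open PrimeFactorisation
  f : PrimeFactorisation n
  f = factorise n
  fromFactors : (qs : List ℕ) → n ≡ product qs → All Prime qs → ∃[ q ] Prime q × q ∣ n
  fromFactors (q ∷ qs) n≡ (pq ∷ _) = q , pq , subst (q ∣_) (sym n≡) (m∣m*n (product qs))

-- Euclid: a prime divisor of p! + 1 lies in the interval (p, p! + 1].
euclid : ∀ p → ∃[ q ] Prime q × p < q × q ≤ suc (p !)
euclid p with primeDivisor (suc (p !)) (s≤s (1≤n! p))
... | q , pq , q∣p!+1 = q , pq , ≰⇒> q≰p , ∣⇒≤ q∣p!+1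
  where
  q≰p : ¬ q ≤ p
  q≰p q≤p = nonTrivial⇒≢1 {{prime⇒nonTrivial pq}} (∣1⇒≡1 q∣1)
    where
    q∣1 : q ∣ 1
    q∣1 = ∣m+n∣m⇒∣n (subst (q ∣_) (+-comm 1 (p !)) q∣p!+1)
                    (∣-factorial (<⇒≤ (prime≥2 pq)) q≤p)

firstPrimeFrom-spec : ∀ f s {q} → Prime q → s ≤ q → q < s + f →
                      Prime (firstPrimeFrom f s) × s ≤ firstPrimeFrom f s
firstPrimeFrom-spec zero s _ s≤q q<s+0 =
  contradiction (≤-trans (≤-reflexive (+-identityʳ s)) s≤q) (<⇒≱ q<s+0)
firstPrimeFrom-spec (suc f) s {q} pq s≤q q<s+f+1 with prime? s
... | yes ps = ps , ≤-refl
... | no ¬ps with m≤n⇒m<n∨m≡n s≤q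
...   | inj₂ refl = contradiction pq ¬ps
...   | inj₁ s<q = map₂ (≤-trans (n≤1+n s))
                     (firstPrimeFrom-spec f (suc s) pq s<q (subst (q <_) (+-suc s f) q<s+f+1))

nextPrime-spec : ∀ {q} → 1 ≤ q → Prime (nextPrime q) × q < nextPrime q
nextPrime-spec {q} 1≤q with euclid q
... | r , pr , q<r , r≤q!+1 =
  firstPrimeFrom-spec (q !) (suc q) pr q<r (s≤s (≤-trans r≤q!+1 (+-monoˡ-≤ (q !) 1≤q)))

nextPrime-prime : ∀ {q} → Prime q → Prime (nextPrime q) × q < nextPrime q
nextPrime-prime pq = nextPrime-spec (<⇒≤ (prime≥2 pq))

prime⇒∤ : ∀ {d q} → Prime q → .{{NonTrivial d}} → d < q → ¬ d ∣ q
prime⇒∤ pq d<q d∣q = Prime.notComposite pq (composite d<q d∣q)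

residue2 : ∀ n → 2 ∣ n ⊎ 2 ∣ suc n
residue2 zero = inj₁ (2 ∣0)
residue2 (suc n) with residue2 n
... | inj₁ 2∣n = inj₂ (∣m∣n⇒∣m+n ∣-refl 2∣n)
... | inj₂ 2∣n+1 = inj₁ 2∣n+1

residue3 : ∀ n → 3 ∣ n ⊎ 3 ∣ suc n ⊎ 3 ∣ 2 + n
residue3 zero = inj₁ (3 ∣0)
residue3 (suc n) with residue3 n
... | inj₁ 3∣n = inj₂ (inj₂ (∣m∣n⇒∣m+n ∣-refl 3∣n))
... | inj₂ (inj₁ 3∣n+1) = inj₁ 3∣n+1
... | inj₂ (inj₂ 3∣n+2) = inj₂ (inj₁ 3∣n+2)

odd-prime : ∀ {q} → Prime q → 3 ≤ q → 2 ∣ suc q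
odd-prime {q} pq 3≤q with residue2 q
... | inj₁ 2∣q = contradiction 2∣q (prime⇒∤ pq 3≤q)
... | inj₂ 2∣q+1 = 2∣q+1

gap-two : ∀ {q r} → Prime q → Prime r → 3 ≤ q → q < r → 2 + q ≤ r
gap-two {q} {r} pq pr 3≤q q<r = ≤∧≢⇒< q<r r≢q+1
  where
  r≢q+1 : suc q ≢ r
  r≢q+1 refl = prime⇒∤ pr (≤-trans 3≤q (n≤1+n q)) (odd-prime pq 3≤q)

-- Of three increasing primes ≥ 5 the last exceeds the first by at least 6:
-- q + 4 is excluded modulo 3 and q + 5 modulo 2.
gap-six : ∀ {q q₁ q₂} → Prime q → Prime q₁ → Prime q₂ → 5 ≤ q → q < q₁ → q₁ < q₂ → 6 + q ≤ q₂
gap-six {q} {q₁} {q₂} pq pq₁ pq₂ 5≤q q<q₁ q₁<q₂ = ≤∧≢⇒< (≤∧≢⇒< q+4≤q₂ q₂≢q+4) q₂≢q+5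
  where
  3≤q : 3 ≤ q
  3≤q = ≤-trans (s≤s (s≤s (s≤s z≤n))) 5≤q
  q+2≤q₁ : 2 + q ≤ q₁
  q+2≤q₁ = gap-two pq pq₁ 3≤q q<q₁
  q₁+2≤q₂ : 2 + q₁ ≤ q₂
  q₁+2≤q₂ = gap-two pq₁ pq₂ (≤-trans 3≤q (<⇒≤ q<q₁)) q₁<q₂
  q+4≤q₂ : 4 + q ≤ q₂
  q+4≤q₂ = ≤-trans (+-monoʳ-≤ 2 q+2≤q₁) q₁+2≤q₂
  q₂≢q+5 : 5 + q ≢ q₂
  q₂≢q+5 eq = prime⇒∤ pq₂ (≤-trans (m≤m+n 3 (2 + q)) (≤-reflexive eq))
                (subst (2 ∣_) eq (∣m∣n⇒∣m+n ∣-refl (∣m∣n⇒∣m+n ∣-refl (odd-prime pq 3≤q))))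
  q₂≢q+4 : 4 + q ≢ q₂
  q₂≢q+4 eq with residue3 q
  ... | inj₁ 3∣q = prime⇒∤ pq (≤-trans (m≤m+n 4 1) 5≤q) 3∣q
  ... | inj₂ (inj₁ 3∣q+1) = prime⇒∤ pq₂ (≤-trans (m≤m+n 4 q) (≤-reflexive eq))
                              (subst (3 ∣_) eq (∣m∣n⇒∣m+n ∣-refl 3∣q+1))
  ... | inj₂ (inj₂ 3∣q+2) = prime⇒∤ pq₁ (≤-trans (+-monoʳ-≤ 2 (≤-trans (m≤m+n 2 1) 3≤q)) q+2≤q₁)
                              (subst (3 ∣_) (sym q₁≡q+2) 3∣q+2)
    where
    q₁≡q+2 : q₁ ≡ 2 + q
    q₁≡q+2 = ≤-antisym (+-cancelˡ-≤ 2 _ _ (≤-trans q₁+2≤q₂ (≤-reflexive (sym eq)))) q+2≤q₁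

primeProduct : ℕ → ℕ → ℚ
primeProduct q zero = ℚ.1ℚ
primeProduct q (suc k) = factor q ℚ.* primeProduct (nextPrime q) k

num : ℕ → ℕ → ℕ
num q zero = 1
num q (suc k) = q * num (nextPrime q) k

den : ℕ → ℕ → ℕ
den q zero = 1
den q (suc k) = (q ∸ 1) * den (nextPrime q) k

prodFrom≡primeProduct : ∀ m k → prodFrom (suc m) k ≡ primeProduct (P (suc m)) k
prodFrom≡primeProduct m zero = refl
prodFrom≡primeProduct m (suc k) = cong (factor (P (suc m)) ℚ.*_) (prodFrom≡primeProduct (suc m) k)

den-pos : ∀ k {q} → Prime q → 1 ≤ den q k
den-pos zero _ = ≤-refl
den-pos (suc k) pq = *-mono-≤ (∸-monoˡ-≤ 1 (prime≥2 pq)) (den-pos k (proj₁ (nextPrime-prime pq)))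

-- Denominators d ≥ 1 are stored as d ∸ 1 in ℚᵘ.
pred-suc : ∀ {d} → 1 ≤ d → suc (d ∸ 1) ≡ d
pred-suc {suc d} _ = refl

primeProduct-≃ : ∀ k {q} → Prime q → toℚᵘ (primeProduct q k) ≃ mkℚᵘ (+ num q k) (den q k ∸ 1)
primeProduct-≃ zero _ = ℚᵘ.≃-refl
primeProduct-≃ (suc k) {q@(suc (suc r))} pq =
  ℚᵘ.≃-trans (ℚ.toℚᵘ-homo-* (factor q) (primeProduct q′ k))
  (ℚᵘ.≃-trans (ℚᵘ.*-cong (ℚ.toℚᵘ-fromℚᵘ (mkℚᵘ (+ q) r)) (primeProduct-≃ k pq′))
  (ℚᵘ.≃-reflexive (cong₂ mkℚᵘ (sym (ℤ.pos-* q (num q′ k))) denominator)))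
  where
  q′ : ℕ
  q′ = nextPrime q
  pq′ : Prime q′
  pq′ = proj₁ (nextPrime-prime pq)
  denominator : (den q′ k ∸ 1) + r * suc (den q′ k ∸ 1) ≡ (suc r * den q′ k) ∸ 1
  denominator = cong (λ d → (suc r * d) ∸ 1) (pred-suc (den-pos k pq′))

exceeds-two : ∀ k {q} → Prime q → two ℚ.< primeProduct q k → 2 * den q k < num q k
exceeds-two k {q} pq two<prod with ℚᵘ.<-respʳ-≃ (primeProduct-≃ k pq) (ℚ.toℚᵘ-mono-< two<prod)
... | *<* 2D<N = subst₂ _<_ (cong (2 *_) (pred-suc (den-pos k pq))) (*-identityʳ (num q k))
                   (ℤ.drop‿+<+ (subst₂ ℤ._<_ (sym (ℤ.pos-* 2 (suc (den q k ∸ 1)))) (sym (ℤ.pos-* (num q k) 1)) 2D<N))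

ratio-step : ∀ k q → num q k * den q (suc k) ≤ num q (suc k) * den q k
ratio-step zero q = begin
  1 * ((q ∸ 1) * 1) ≤⟨ *-monoʳ-≤ 1 (*-monoˡ-≤ 1 (m∸n≤m q 1)) ⟩
  1 * (q * 1)       ≡⟨ *-comm 1 (q * 1) ⟩
  (q * 1) * 1       ∎
  where open ≤-Reasoning
ratio-step (suc k) q = begin
  (q * N) * ((q ∸ 1) * D′)  ≡⟨ interchange q (q ∸ 1) N D′ ⟩
  (q * (q ∸ 1)) * (N * D′)  ≤⟨ *-monoʳ-≤ (q * (q ∸ 1)) (ratio-step k (nextPrime q)) ⟩
  (q * (q ∸ 1)) * (N′ * D)  ≡⟨ interchange q (q ∸ 1) N′ D ⟨
  (q * N′) * ((q ∸ 1) * D)  ∎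
  where
  open ≤-Reasoning
  N N′ D D′ : ℕ
  N = num (nextPrime q) k
  N′ = num (nextPrime q) (suc k)
  D = den (nextPrime q) k
  D′ = den (nextPrime q) (suc k)
  interchange : ∀ a b c d → (a * c) * (b * d) ≡ (a * b) * (c * d)
  interchange = solve-∀

exceeds-two-step : ∀ k {q} → Prime q → 2 * den q k < num q k → 2 * den q (suc k) < num q (suc k)
exceeds-two-step k {q} pq 2D<N = *-cancelʳ-< _ (2 * den q (suc k)) (num q (suc k)) (begin-strict
  2 * den q (suc k) * den q k  ≡⟨ swap (den q (suc k)) (den q k) ⟩
  2 * den q k * den q (suc k)  <⟨ *-monoˡ-< (den q (suc k)) {{>-nonZero (den-pos (suc k) pq)}} 2D<N ⟩
  num q k * den q (suc k)      ≤⟨ ratio-step k q ⟩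
  num q (suc k) * den q k      ∎)
  where
  open ≤-Reasoning
  swap : ∀ a b → 2 * a * b ≡ 2 * b * a
  swap = solve-∀

exceeds-two-upward : ∀ {k l q} → Prime q → k ≤ l → 2 * den q k < num q k → 2 * den q l < num q l
exceeds-two-upward {q = q} pq k≤l = go (≤⇒≤′ k≤l)
  where
  go : ∀ {k l} → k ≤′ l → 2 * den q k < num q k → 2 * den q l < num q l
  go ≤′-refl 2D<N = 2D<N
  go (≤′-step {l} k≤′l) 2D<N = exceeds-two-step l pq (go k≤′l 2D<N)

cube : ℕ → ℕ
cube x = x * x * x

cube-mono-≤ : ∀ {a b} → a ≤ b → cube a ≤ cube b
cube-mono-≤ a≤b = *-mono-≤ (*-mono-≤ a≤b a≤b) a≤b

cube-cancel-≤ : ∀ {a b} → cube a ≤ cube b → a ≤ b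
cube-cancel-≤ {a} {b} a³≤b³ = ≮⇒≥ λ b<a → <⇒≱ (*-mono-< (*-mono-< b<a b<a) b<a) a³≤b³

ratio-antitone : ∀ {m b} → suc m ≤ b → suc b * suc m ≤ b * (2 + m)
ratio-antitone {m} {b} m<b = begin
  suc m + b * suc m  ≤⟨ +-monoˡ-≤ (b * suc m) m<b ⟩
  b + b * suc m      ≡⟨ *-suc b (suc m) ⟨
  b * (2 + m)        ∎
  where open ≤-Reasoning

-- The key estimate ((m+2)/(m+1))³ ≤ (m+3)/m: the two sides differ by 2m+3.
cube-estimate : ∀ m → cube (2 + m) * m ≤ cube (1 + m) * (3 + m)
cube-estimate m = subst (cube (2 + m) * m ≤_) (sym (expand m)) (m≤m+n _ (3 + 2 * m))
  where
  expand : ∀ m → (1 + m) * (1 + m) * (1 + m) * (3 + m) ≡ (2 + m) * (2 + m) * (2 + m) * m + (3 + 2 * m)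
  expand = solve-∀

cube-factor : ∀ {m a} → 2 + m ≤ a → cube a * m ≤ cube (a ∸ 1) * (3 + m)
cube-factor {m} {suc b} (s≤s m<b) = *-cancelʳ-≤ _ _ (cube (suc m)) (begin
  cube (suc b) * m * cube (suc m)       ≡⟨ collect (suc b) (suc m) m ⟩
  cube (suc b * suc m) * m              ≤⟨ *-monoˡ-≤ m (cube-mono-≤ (ratio-antitone m<b)) ⟩
  cube (b * (2 + m)) * m                ≡⟨ distribute b (2 + m) m ⟩
  cube b * (cube (2 + m) * m)           ≤⟨ *-monoʳ-≤ (cube b) (cube-estimate m) ⟩
  cube b * (cube (1 + m) * (3 + m))     ≡⟨ reorder (cube b) (cube (1 + m)) (3 + m) ⟩
  cube b * (3 + m) * cube (suc m)       ∎)
  where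
  open ≤-Reasoning
  collect : ∀ x y z → x * x * x * z * (y * y * y) ≡ (x * y) * (x * y) * (x * y) * z
  collect = solve-∀
  distribute : ∀ x y z → (x * y) * (x * y) * (x * y) * z ≡ x * x * x * (y * y * y * z)
  distribute = solve-∀
  reorder : ∀ x y z → x * (y * z) ≡ x * z * y
  reorder = solve-∀

-- Two prime factors: (a/(a−1))³ (c/(c−1))³ ≤ (y+6)/y for a ≥ y + 3, c ≥ y + 5,
-- from the one-factor bounds with m = y+1 and m = y+3 and y(y+4) ≤ (y+1)(y+3).
pair-factor : ∀ {y a c} → 3 + y ≤ a → 5 + y ≤ c →
              cube a * cube c * y ≤ cube (a ∸ 1) * cube (c ∸ 1) * (6 + y)
pair-factor {y} {a} {c} y+3≤a y+5≤c = *-cancelʳ-≤ _ _ ((1 + y) * (3 + y)) (begin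
  A * C * y * ((1 + y) * (3 + y))           ≡⟨ regroup A C (1 + y) (3 + y) y ⟩
  (A * (1 + y)) * (C * (3 + y)) * y         ≤⟨ *-monoˡ-≤ y (*-mono-≤ (cube-factor y+3≤a) (cube-factor y+5≤c)) ⟩
  (A′ * (4 + y)) * (C′ * (6 + y)) * y       ≡⟨ regroup′ A′ C′ (4 + y) (6 + y) y ⟩
  A′ * C′ * (6 + y) * (y * (4 + y))         ≤⟨ *-monoʳ-≤ (A′ * C′ * (6 + y)) y[y+4]≤[y+1][y+3] ⟩
  A′ * C′ * (6 + y) * ((1 + y) * (3 + y))   ∎)
  where
  open ≤-Reasoning
  A C A′ C′ : ℕ
  A = cube a
  C = cube c
  A′ = cube (a ∸ 1)
  C′ = cube (c ∸ 1)
  regroup : ∀ x z u v w → x * z * w * (u * v) ≡ (x * u) * (z * v) * w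
  regroup = solve-∀
  regroup′ : ∀ x z u v w → (x * u) * (z * v) * w ≡ x * z * v * (w * u)
  regroup′ = solve-∀
  expand : ∀ y → (1 + y) * (3 + y) ≡ y * (4 + y) + 3
  expand = solve-∀
  y[y+4]≤[y+1][y+3] : y * (4 + y) ≤ (1 + y) * (3 + y)
  y[y+4]≤[y+1][y+3] = subst (y * (4 + y) ≤_) (sym (expand y)) (m≤m+n _ 3)

-- Telescoping over j pairs of consecutive primes, starting at a prime q ≥ max(5, y+3):
-- (∏ over 2j primes)³ ≤ (y + 6j)/y.  The gap lemma moves y to y + 6 per pair.
telescope : ∀ j {q y} → Prime q → 5 ≤ q → 3 + y ≤ q →
            cube (num q (j * 2)) * y ≤ cube (den q (j * 2)) * (y + j * 6)
telescope zero {y = y} _ _ _ = m≤m+n (y + 0) 0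
telescope (suc j) {q} {y} pq 5≤q y+3≤q = *-cancelʳ-≤ _ _ (6 + y) (begin
  cube (q * (q₁ * N)) * y * (6 + y)                          ≡⟨ separated ⟩
  (cube q * cube q₁ * y) * (cube N * (6 + y))                ≤⟨ *-mono-≤ first-pair remaining-pairs ⟩
  (cube q′ * cube q₁′ * (6 + y)) * (cube D * (6 + y + j * 6)) ≡⟨ joined ⟩
  cube (q′ * (q₁′ * D)) * (y + (6 + j * 6)) * (6 + y)        ∎)
  where
  open ≤-Reasoning
  q₁ q₂ q′ q₁′ N D : ℕ
  q₁ = nextPrime q
  q₂ = nextPrime q₁
  q′ = q ∸ 1
  q₁′ = q₁ ∸ 1
  N = num q₂ (j * 2)
  D = den q₂ (j * 2)
  next₁ : Prime q₁ × q < q₁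
  next₁ = nextPrime-prime pq
  next₂ : Prime q₂ × q₁ < q₂
  next₂ = nextPrime-prime (proj₁ next₁)
  q+6≤q₂ : 6 + q ≤ q₂
  q+6≤q₂ = gap-six pq (proj₁ next₁) (proj₁ next₂) 5≤q (proj₂ next₁) (proj₂ next₂)
  first-pair : cube q * cube q₁ * y ≤ cube q′ * cube q₁′ * (6 + y)
  first-pair = pair-factor y+3≤q (≤-trans (+-monoʳ-≤ 2 y+3≤q)
                 (gap-two pq (proj₁ next₁) (≤-trans (m≤m+n 3 2) 5≤q) (proj₂ next₁)))
  remaining-pairs : cube N * (6 + y) ≤ cube D * (6 + y + j * 6)
  remaining-pairs = telescope j (proj₁ next₂) (≤-trans (m≤n+m 5 6) (≤-trans (+-monoʳ-≤ 6 5≤q) q+6≤q₂))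
                      (≤-trans (+-monoʳ-≤ 6 y+3≤q) q+6≤q₂)
  separated : cube (q * (q₁ * N)) * y * (6 + y) ≡ (cube q * cube q₁ * y) * (cube N * (6 + y))
  separated = split q q₁ N y (6 + y)
    where
    split : ∀ a b n u v → (a * (b * n)) * (a * (b * n)) * (a * (b * n)) * u * v
                        ≡ (a * a * a * (b * b * b) * u) * (n * n * n * v)
    split = solve-∀
  joined : (cube q′ * cube q₁′ * (6 + y)) * (cube D * (6 + y + j * 6))
         ≡ cube (q′ * (q₁′ * D)) * (y + (6 + j * 6)) * (6 + y)
  joined = join q′ q₁′ D y (j * 6)
    where
    join : ∀ a b d u w → (a * a * a * (b * b * b) * (6 + u)) * (d * d * d * (6 + u + w))
                       ≡ (a * (b * d)) * (a * (b * d)) * (a * (b * d)) * (u + (6 + w)) * (6 + u)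
    join = solve-∀

y+6[p+1]≤8y : ∀ {p y} → 3 + y ≡ p → 24 ≤ y → y + suc p * 6 ≤ 8 * y
y+6[p+1]≤8y {y = y} refl 24≤y = begin
  y + (4 + y) * 6 ≡⟨ expand y ⟩
  24 + 7 * y      ≤⟨ +-monoˡ-≤ (7 * y) 24≤y ⟩
  y + 7 * y       ∎
  where
  open ≤-Reasoning
  expand : ∀ y → y + (4 + y) * 6 ≡ 24 + 7 * y
  expand = solve-∀

-- For p ≥ 27 the telescope over p + 1 pairs gives (∏)³ ≤ (y + 6(p+1))/y ≤ 8 with y = p − 3.
-- (p is kept abstract: unfolding num/den at a concrete prime would be a huge computation.)
large : ∀ {p} → Prime p → 27 ≤ p → num p (2 * p + 2) ≤ 2 * den p (2 * p + 2)
large {p} pp 27≤p = subst (λ k → num p k ≤ 2 * den p k) (length≡ p)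
  (cube-cancel-≤ (*-cancelʳ-≤ _ _ y {{>-nonZero (≤-trans (s≤s z≤n) 24≤y)}} (begin
    cube N * y               ≤⟨ telescope (suc p) pp (≤-trans (m≤m+n 5 22) 27≤p) (≤-reflexive p≡3+y) ⟩
    cube D * (y + suc p * 6) ≤⟨ *-monoʳ-≤ (cube D) (y+6[p+1]≤8y p≡3+y 24≤y) ⟩
    cube D * (8 * y)         ≡⟨ doubled ⟩
    cube (2 * D) * y         ∎)))
  where
  open ≤-Reasoning
  y N D : ℕ
  y = p ∸ 3
  p≡3+y : 3 + y ≡ p
  p≡3+y = m+[n∸m]≡n (≤-trans (m≤m+n 3 24) 27≤p)
  24≤y : 24 ≤ y
  24≤y = ∸-monoˡ-≤ 3 27≤p
  N = num p (suc p * 2)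
  D = den p (suc p * 2)
  length≡ : ∀ p → suc p * 2 ≡ 2 * p + 2
  length≡ = solve-∀
  doubled : cube D * (8 * y) ≡ cube (2 * D) * y
  doubled = double D y
    where
    double : ∀ d u → d * d * d * (8 * u) ≡ (2 * d) * (2 * d) * (2 * d) * u
    double = solve-∀

small : ∀ {p} → p < 27 → 11 ≤ p → Prime p → num p (2 * p + 2) ≤ 2 * den p (2 * p + 2)
small = toWitness {a? = allUpTo? (λ p → (11 ≤? p) →-dec (prime? p →-dec
                                    (num p (2 * p + 2) ≤? 2 * den p (2 * p + 2)))) 27} tt

at-most-two : ∀ {p} → Prime p → 11 ≤ p → num p (2 * p + 2) ≤ 2 * den p (2 * p + 2)
at-most-two {p} pp 11≤p with p <? 27
... | yes p<27 = small p<27 11≤p pp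
... | no p≮27 = large pp (≮⇒≥ p≮27)

corollary3 : (p : ℕ) → Prime p → 11 ≤ p →
    (n : ℕ) → 1 < n → P n ≡ p →
    (a : ℕ) → IsA n a → 2 * p + 2 ≤ a
corollary3 _ pp 11≤p (suc m) _ refl a (_ , two<prodFrom) =
  ≮⇒≥ λ a<2p+2 → <⇒≱ (exceeds-two-upward pp (<⇒≤ a<2p+2) exceeds-at-a) (at-most-two pp 11≤p)
  where
  exceeds-at-a : 2 * den (P (suc m)) a < num (P (suc m)) a
  exceeds-at-a = exceeds-two a pp (subst (two ℚ.<_) (prodFrom≡primeProduct m a) two<prodFrom)
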